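{- There exist preordered spaces $(X,\preceq)$ such that $X/\mathord{\sim}$ is countably infinite and no finite multi-utility of $\preceq$ exists.
   Context: A preorder is a reflexive transitive relation $\preceq$ on a set $X$. $x\sim y$ means $x\preceq y$ and $y\preceq x$; $X/\mathord{\sim}$ is the set of equivalence classes. A family $V$ of functions $X\to\mathbb{R}$ is a multi-utility if for all $x,y\in X$: $x\preceq y \iff v(x)\le v(y)$ for all $v\in V$; it is finite if $V$ is a finite family. -}

module Defs where

open import Level using (0ℓ)
open import Data.Nat using (ℕ)
open import Data.Fin using (Fin)
open import Data.Product using (Σ; _×_; ∃)
open import Relation.Binary.Core using (Rel)
open import Relation.Binary.Bundles using (TotalOrder)
open import Relation.Binary.PropositionalEquality using (_≡_)
open import Function.Bundles using (_⇔_)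

Equiv : {X : Set} → Rel X 0ℓ → Rel X 0ℓ
Equiv _≼_ x y = (x ≼ y) × (y ≼ x)

-- X/∼ is countably infinite: there is a bijection ℕ ≅ X/∼, given by
-- e : ℕ → X hitting every class, with distinct indices in distinct classes.
QuotientCountablyInfinite : (X : Set) → Rel X 0ℓ → Set
QuotientCountablyInfinite X _≼_ =
  Σ (ℕ → X) λ e →
    (∀ i j → Equiv _≼_ (e i) (e j) → i ≡ j) ×
    (∀ x → ∃ λ i → Equiv _≼_ x (e i))

IsMultiUtility : (R : TotalOrder 0ℓ 0ℓ 0ℓ) {X : Set} (_≼_ : Rel X 0ℓ)
                 {I : Set} → (I → X → TotalOrder.Carrier R) → Set
IsMultiUtility R {X} _≼_ {I} V =
  ∀ (x y : X) → (x ≼ y) ⇔ (∀ (v : I) → TotalOrder._≤_ R (V v x) (V v y))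

FiniteMultiUtility : (R : TotalOrder 0ℓ 0ℓ 0ℓ) {X : Set} (_≼_ : Rel X 0ℓ) → Set
FiniteMultiUtility R {X} _≼_ =
  Σ ℕ λ n → Σ (Fin n → X → TotalOrder.Carrier R) λ V → IsMultiUtility R _≼_ V

module Submission where

open import Level using (0ℓ)
open import Data.Product using (Σ; _×_; _,_; proj₁; proj₂; ∃)
open import Data.Nat using (ℕ; zero; suc; _<_)
open import Data.Nat.Properties using (n<1+n)
open import Data.Fin as Fin using (Fin; toℕ)
open import Data.Fin.Properties using (∀-cons; pigeonhole; toℕ-injective; <⇒≢)
open import Function using (_∘_)
open import Function.Bundles using (Equivalence; _↔_; mk↔ₛ′; Inverse)
open import Relation.Binary.Core using (Rel)
open import Relation.Binary.Bundles using (TotalOrder)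
open import Relation.Binary.Structures using (IsPreorder)
open import Relation.Binary.PropositionalEquality
  using (_≡_; _≢_; refl; sym; trans; cong; subst; isEquivalence; module ≡-Reasoning)
open import Relation.Nullary using (¬_)
open import Relation.Nullary.Negation using (¬¬-map)
import Relation.Binary.Properties.TotalOrder as TotalOrderProperties
open import Defs

-- The example is the standard crown: points lᵢ, hⱼ (i, j ∈ ℕ) with lᵢ ≺ hⱼ exactly
-- when i ≢ j. It is a partial order, so X/∼ is X itself, which is countable.
-- A multi-utility (vᵤ)_{u < n} must reverse each pair lᵢ, hᵢ in some coordinate uᵢ.
-- Among n + 1 such pairs two, i ≢ j, share a coordinate u, and then
-- vᵤ lᵢ ≤ vᵤ hⱼ ≤ vᵤ lⱼ ≤ vᵤ hᵢ, contradicting the reversal of lᵢ, hᵢ.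
-- The order in R is not decidable, so the coordinates uᵢ are only chosen
-- under double negation, which suffices since the goal is ⊥.

¬¬-Π-Fin : ∀ {n} {P : Fin n → Set} → (∀ i → ¬ ¬ P i) → ¬ ¬ (∀ i → P i)
¬¬-Π-Fin {zero}  _ k = k (λ ())
¬¬-Π-Fin {suc n} h k = h Fin.zero λ p₀ → ¬¬-Π-Fin (h ∘ Fin.suc) (k ∘ ∀-cons p₀)

¬∀⇒¬¬∃¬-Fin : ∀ {n} {P : Fin n → Set} → ¬ (∀ i → P i) → ¬ ¬ ∃ λ i → ¬ P i
¬∀⇒¬¬∃¬-Fin ¬∀P k = ¬¬-Π-Fin (λ i pᵢ → k (i , pᵢ)) ¬∀P

¬¬-choice-Fin : ∀ {m} {B : Set} {Q : Fin m → B → Set} →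
                (∀ i → ¬ ¬ ∃ (Q i)) → ¬ ¬ ∃ λ (f : Fin m → B) → ∀ i → Q i (f i)
¬¬-choice-Fin h = ¬¬-map (λ q → proj₁ ∘ q , proj₂ ∘ q) (¬¬-Π-Fin h)

crown⇒¬IsMultiUtility :
  (R : TotalOrder 0ℓ 0ℓ 0ℓ) {X : Set} {_≼_ : Rel X 0ℓ} {m n : ℕ} → n < m →
  (l h : Fin m → X) → (∀ {i j} → i ≢ j → l i ≼ h j) → (∀ i → ¬ l i ≼ h i) →
  (V : Fin n → X → TotalOrder.Carrier R) → ¬ IsMultiUtility R _≼_ V
crown⇒¬IsMultiUtility R {_≼_ = _≼_} n<m l h l≼h l⋠h V isMU =
  ¬¬-choice-Fin reversed sharedCoordinate
  where
  open TotalOrder R using (_≤_) renaming (trans to ≤-trans)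
  open TotalOrderProperties R using (≰⇒≥)

  monotone : ∀ {x y} → x ≼ y → ∀ u → V u x ≤ V u y
  monotone {x} {y} = Equivalence.to (isMU x y)

  reversed : ∀ i → ¬ ¬ ∃ λ u → ¬ V u (l i) ≤ V u (h i)
  reversed i = ¬∀⇒¬¬∃¬-Fin (l⋠h i ∘ Equivalence.from (isMU (l i) (h i)))

  sharedCoordinate : ¬ ∃ λ f → ∀ i → ¬ V (f i) (l i) ≤ V (f i) (h i)
  sharedCoordinate (f , rev) with i , j , i<j , fᵢ≡fⱼ ← pigeonhole n<m f =
    rev i (≤-trans (monotone (l≼h i≢j) u)
          (≤-trans hⱼ≤lⱼ
                   (monotone (l≼h (i≢j ∘ sym)) u)))
    where
    u : Fin _
    u = f i
    i≢j : i ≢ j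
    i≢j = <⇒≢ i<j
    hⱼ≤lⱼ : V u (h j) ≤ V u (l j)
    hⱼ≤lⱼ = subst (λ w → V w (h j) ≤ V w (l j)) (sym fᵢ≡fⱼ) (≰⇒≥ (rev j))

QuotientCountablyInfinite-↔ : {X : Set} {_≼_ : Rel X 0ℓ} →
  (∀ {x} → x ≼ x) → (∀ {x y} → Equiv _≼_ x y → x ≡ y) →
  ℕ ↔ X → QuotientCountablyInfinite X _≼_
QuotientCountablyInfinite-↔ {_≼_ = _≼_} refl≼ antisym e =
  to , injective , λ x → from x , subst (Equiv _≼_ x) (sym (strictlyInverseˡ x)) (refl≼ , refl≼)
  where
  open Inverse e
  open ≡-Reasoning
  injective : ∀ i j → Equiv _≼_ (to i) (to j) → i ≡ j
  injective i j i∼j = begin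
    i             ≡⟨ strictlyInverseʳ i ⟨
    from (to i)   ≡⟨ cong from (antisym i∼j) ⟩
    from (to j)   ≡⟨ strictlyInverseʳ j ⟩
    j             ∎

data Crown : Set where
  low high : ℕ → Crown

data _≼_ : Rel Crown 0ℓ where
  ≼-refl   : ∀ {x} → x ≼ x
  low≼high : ∀ {i j} → i ≢ j → low i ≼ high j

≼-trans : ∀ {x y z} → x ≼ y → y ≼ z → x ≼ z
≼-trans ≼-refl         y≼z    = y≼z
≼-trans (low≼high i≢j) ≼-refl = low≼high i≢j

≼-isPreorder : IsPreorder _≡_ _≼_
≼-isPreorder = record
  { isEquivalence = isEquivalence
  ; reflexive     = λ { refl → ≼-refl }
  ; trans         = ≼-trans
  }

≼-antisym : ∀ {x y} → Equiv _≼_ x y → x ≡ y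
≼-antisym (≼-refl , _) = refl

low⋠high : ∀ k → ¬ low k ≼ high k
low⋠high k (low≼high k≢k) = k≢k refl

shift : Crown → Crown
shift (low k)  = low (suc k)
shift (high k) = high (suc k)

-- 2k ↦ low k and 2k + 1 ↦ high k
enumerate : ℕ → Crown
enumerate zero          = low zero
enumerate (suc zero)    = high zero
enumerate (suc (suc n)) = shift (enumerate n)

index : Crown → ℕ
index (low zero)     = zero
index (high zero)    = suc zero
index (low (suc k))  = suc (suc (index (low k)))
index (high (suc k)) = suc (suc (index (high k)))

index-shift : ∀ x → index (shift x) ≡ suc (suc (index x))
index-shift (low _)  = refl
index-shift (high _) = refl

index-enumerate : ∀ n → index (enumerate n) ≡ n
index-enumerate zero          = refl
index-enumerate (suc zero)    = refl
index-enumerate (suc (suc n)) =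
  trans (index-shift (enumerate n)) (cong (suc ∘ suc) (index-enumerate n))

enumerate-index : ∀ x → enumerate (index x) ≡ x
enumerate-index (low zero)     = refl
enumerate-index (high zero)    = refl
enumerate-index (low (suc k))  = cong shift (enumerate-index (low k))
enumerate-index (high (suc k)) = cong shift (enumerate-index (high k))

ℕ↔Crown : ℕ ↔ Crown
ℕ↔Crown = mk↔ₛ′ enumerate index enumerate-index index-enumerate

Crown-¬FiniteMultiUtility : ∀ R → ¬ FiniteMultiUtility R _≼_
Crown-¬FiniteMultiUtility R (n , V , isMU) =
  crown⇒¬IsMultiUtility R (n<1+n n) (low ∘ toℕ) (high ∘ toℕ)
    (λ i≢j → low≼high (i≢j ∘ toℕ-injective)) (low⋠high ∘ toℕ) V isMU

proposition7 : Σ Set λ X → Σ (Rel X 0ℓ) λ _≼_ →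
    IsPreorder _≡_ _≼_ ×
    QuotientCountablyInfinite X _≼_ ×
    (∀ (R : TotalOrder 0ℓ 0ℓ 0ℓ) → ¬ FiniteMultiUtility R _≼_)
proposition7 =
  Crown , _≼_ , ≼-isPreorder ,
  QuotientCountablyInfinite-↔ ≼-refl ≼-antisym ℕ↔Crown ,
  Crown-¬FiniteMultiUtility
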